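{- For every $\Sigma$-sentence $\phi$ of $\mathcal{L}_{BT}$: if $\mathfrak{B}\models\phi$, then $B\vdash\phi$.
   Context: Bit strings are elements of $\{\mathbf{0},\mathbf{1}\}^*$; $\varepsilon$ is the empty string. The first-order language $\mathcal{L}_{BT}$ has constant symbols $e,0,1$, a binary function symbol $\circ$ (also written as juxtaposition, $st$ for $s\circ t$), and a binary relation symbol $\sqsubseteq$. The $\mathcal{L}_{BT}$-structure $\mathfrak{B}$ has universe $\{\mathbf{0},\mathbf{1}\}^*$, interprets $e$ as $\varepsilon$, $0$ as $\mathbf{0}$, $1$ as $\mathbf{1}$, $\circ$ as concatenation, and $\sqsubseteq$ as the substring relation ($\alpha\sqsubseteq\beta$ iff $\gamma\alpha\delta=\beta$ for some bit strings $\gamma,\delta$). Bounded quantifiers: $(\exists x\sqsubseteq t)\phi$ abbreviates $\exists x[x\sqsubseteq t\wedge\phi]$ and $(\forall x\sqsubseteq t)\phi$ abbreviates $\forall x[x\sqsubseteq t\to\phi]$. $\Sigma$-formulas are defined inductively: $s\sqsubseteq t$, $\neg s\sqsubseteq t$, $s=t$, $\neg s=t$ (for terms $s,t$) are $\Sigma$-formulas; if $\phi,\psi$ are $\Sigma$-formulas then so are $\phi\wedge\psi$ and $\phi\vee\psi$; if $\phi$ is a $\Sigma$-formula, $t$ a term and $x$ a variable not occurring in $t$, then $(\exists x\sqsubseteq t)\phi$, $(\forall x\sqsubseteq t)\phi$ and $\exists x\,\phi$ are $\Sigma$-formulas. The theory $B$ has the eleven axioms: (1) $\forall x[x=ex\wedge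 x=xe]$; (2) $\forall xyz[(xy)z=x(yz)]$; (3) $\forall xy[x\neq y\to(x0\neq y0\wedge x1\neq y1)]$; (4) $\forall xy[x0\neq y1]$; (5) $\forall x[x\sqsubseteq e\leftrightarrow x=e]$; (6) $\forall x[x\sqsubseteq 0\leftrightarrow(x=e\vee x=0)]$; (7) $\forall x[x\sqsubseteq 1\leftrightarrow(x=e\vee x=1)]$; (8)–(11): for each $a,b\in\{0,1\}$, $\forall xy[x\sqsubseteq ayb\leftrightarrow(x=ayb\vee x\sqsubseteq ay\vee x\sqsubseteq yb)]$. -}

module Defs where

open import Data.Nat using (ℕ; zero; suc)
open import Data.Fin using (Fin; zero; suc)
open import Data.List using (List; []; _∷_; _++_; map)
open import Data.List.Membership.Propositional using (_∈_)
open import Data.Product using (Σ; _×_; _,_)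
open import Data.Sum using (_⊎_)
open import Data.Empty using (⊥)
open import Relation.Binary.PropositionalEquality using (_≡_)

data Bit : Set where
  𝟎 𝟏 : Bit

BitString : Set
BitString = List Bit

_≼_ : BitString → BitString → Set
α ≼ β = Σ BitString λ γ → Σ BitString λ δ → γ ++ (α ++ δ) ≡ β

infixl 8 _∙_
data Term (n : ℕ) : Set where
  var : Fin n → Term n
  e   : Term n
  0̇   : Term n
  1̇   : Term n
  _∙_ : Term n → Term n → Term n

infix  6 _⊑_ _≐_
infixr 5 _∧'_
infixr 4 _∨'_
infixr 3 _⇒_ _⇔_
data Formula (n : ℕ) : Set where
  _⊑_ : Term n → Term n → Formula n
  _≐_ : Term n → Term n → Formula n
  ⊥'  : Formula n
  _⇒_ : Formula n → Formula n → Formula n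
  _∧'_ : Formula n → Formula n → Formula n
  _∨'_ : Formula n → Formula n → Formula n
  ∀'  : Formula (suc n) → Formula n
  ∃'  : Formula (suc n) → Formula n

¬' : ∀ {n} → Formula n → Formula n
¬' φ = φ ⇒ ⊥'

_⇔_ : ∀ {n} → Formula n → Formula n → Formula n
φ ⇔ ψ = (φ ⇒ ψ) ∧' (ψ ⇒ φ)

Sentence : Set
Sentence = Formula 0

Ren : ℕ → ℕ → Set
Ren m n = Fin m → Fin n

extR : ∀ {m n} → Ren m n → Ren (suc m) (suc n)
extR ρ zero = zero
extR ρ (suc i) = suc (ρ i)

renT : ∀ {m n} → Ren m n → Term m → Term n
renT ρ (var i) = var (ρ i)
renT ρ e = e
renT ρ 0̇ = 0̇
renT ρ 1̇ = 1̇
renT ρ (s ∙ t) = renT ρ s ∙ renT ρ t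

renF : ∀ {m n} → Ren m n → Formula m → Formula n
renF ρ (s ⊑ t) = renT ρ s ⊑ renT ρ t
renF ρ (s ≐ t) = renT ρ s ≐ renT ρ t
renF ρ ⊥' = ⊥'
renF ρ (φ ⇒ ψ) = renF ρ φ ⇒ renF ρ ψ
renF ρ (φ ∧' ψ) = renF ρ φ ∧' renF ρ ψ
renF ρ (φ ∨' ψ) = renF ρ φ ∨' renF ρ ψ
renF ρ (∀' φ) = ∀' (renF (extR ρ) φ)
renF ρ (∃' φ) = ∃' (renF (extR ρ) φ)

wkT : ∀ {n} → Term n → Term (suc n)
wkT = renT suc

wkF : ∀ {n} → Formula n → Formula (suc n)
wkF = renF suc

Sub : ℕ → ℕ → Set
Sub m n = Fin m → Term n

extS : ∀ {m n} → Sub m n → Sub (suc m) (suc n)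
extS σ zero = var zero
extS σ (suc i) = wkT (σ i)

subT : ∀ {m n} → Sub m n → Term m → Term n
subT σ (var i) = σ i
subT σ e = e
subT σ 0̇ = 0̇
subT σ 1̇ = 1̇
subT σ (s ∙ t) = subT σ s ∙ subT σ t

subF : ∀ {m n} → Sub m n → Formula m → Formula n
subF σ (s ⊑ t) = subT σ s ⊑ subT σ t
subF σ (s ≐ t) = subT σ s ≐ subT σ t
subF σ ⊥' = ⊥'
subF σ (φ ⇒ ψ) = subF σ φ ⇒ subF σ ψ
subF σ (φ ∧' ψ) = subF σ φ ∧' subF σ ψ
subF σ (φ ∨' ψ) = subF σ φ ∨' subF σ ψ
subF σ (∀' φ) = ∀' (subF (extS σ) φ)
subF σ (∃' φ) = ∃' (subF (extS σ) φ)

sub0 : ∀ {n} → Term n → Sub (suc n) n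
sub0 t zero = t
sub0 t (suc i) = var i

_[_] : ∀ {n} → Formula (suc n) → Term n → Formula n
φ [ t ] = subF (sub0 t) φ

-- Bounded quantifiers (the bound variable is var zero; it cannot occur
-- in t, which lives in the outer scope)

∃⊑ : ∀ {n} → Term n → Formula (suc n) → Formula n
∃⊑ t φ = ∃' (var zero ⊑ wkT t ∧' φ)

∀⊑ : ∀ {n} → Term n → Formula (suc n) → Formula n
∀⊑ t φ = ∀' (var zero ⊑ wkT t ⇒ φ)

data IsΣ {n : ℕ} : Formula n → Set where
  σ-⊑   : (s t : Term n) → IsΣ (s ⊑ t)
  σ-¬⊑  : (s t : Term n) → IsΣ (¬' (s ⊑ t))
  σ-≐   : (s t : Term n) → IsΣ (s ≐ t)
  σ-¬≐  : (s t : Term n) → IsΣ (¬' (s ≐ t))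
  σ-∧   : {φ ψ : Formula n} → IsΣ φ → IsΣ ψ → IsΣ (φ ∧' ψ)
  σ-∨   : {φ ψ : Formula n} → IsΣ φ → IsΣ ψ → IsΣ (φ ∨' ψ)
  σ-∃⊑  : (t : Term n) {φ : Formula (suc n)} → IsΣ φ → IsΣ (∃⊑ t φ)
  σ-∀⊑  : (t : Term n) {φ : Formula (suc n)} → IsΣ φ → IsΣ (∀⊑ t φ)
  σ-∃   : {φ : Formula (suc n)} → IsΣ φ → IsΣ (∃' φ)

Env : ℕ → Set
Env n = Fin n → BitString

_∷ᵉ_ : ∀ {n} → BitString → Env n → Env (suc n)
(x ∷ᵉ ρ) zero = x
(x ∷ᵉ ρ) (suc i) = ρ i

⟦_⟧ : ∀ {n} → Term n → Env n → BitString
⟦ var i ⟧ ρ = ρ i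
⟦ e ⟧ ρ = []
⟦ 0̇ ⟧ ρ = 𝟎 ∷ []
⟦ 1̇ ⟧ ρ = 𝟏 ∷ []
⟦ s ∙ t ⟧ ρ = ⟦ s ⟧ ρ ++ ⟦ t ⟧ ρ

_⊨_ : ∀ {n} → Env n → Formula n → Set
ρ ⊨ (s ⊑ t) = ⟦ s ⟧ ρ ≼ ⟦ t ⟧ ρ
ρ ⊨ (s ≐ t) = ⟦ s ⟧ ρ ≡ ⟦ t ⟧ ρ
ρ ⊨ ⊥' = ⊥
ρ ⊨ (φ ⇒ ψ) = ρ ⊨ φ → ρ ⊨ ψ
ρ ⊨ (φ ∧' ψ) = ρ ⊨ φ × ρ ⊨ ψ
ρ ⊨ (φ ∨' ψ) = ρ ⊨ φ ⊎ ρ ⊨ ψ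
ρ ⊨ ∀' φ = (x : BitString) → (x ∷ᵉ ρ) ⊨ φ
ρ ⊨ ∃' φ = Σ BitString λ x → (x ∷ᵉ ρ) ⊨ φ

𝔅⊨ : Sentence → Set
𝔅⊨ φ = (λ ()) ⊨ φ

infix 2 _⊢_
data _⊢_ : {n : ℕ} → List (Formula n) → Formula n → Set where
  hyp  : ∀ {n} {Γ : List (Formula n)} {φ} → φ ∈ Γ → Γ ⊢ φ
  ⊥E   : ∀ {n} {Γ : List (Formula n)} {φ} → Γ ⊢ ⊥' → Γ ⊢ φ
  raa  : ∀ {n} {Γ : List (Formula n)} {φ} → (¬' φ ∷ Γ) ⊢ ⊥' → Γ ⊢ φ
  ⇒I   : ∀ {n} {Γ : List (Formula n)} {φ ψ} → (φ ∷ Γ) ⊢ ψ → Γ ⊢ φ ⇒ ψ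
  ⇒E   : ∀ {n} {Γ : List (Formula n)} {φ ψ} → Γ ⊢ φ ⇒ ψ → Γ ⊢ φ → Γ ⊢ ψ
  ∧I   : ∀ {n} {Γ : List (Formula n)} {φ ψ} → Γ ⊢ φ → Γ ⊢ ψ → Γ ⊢ φ ∧' ψ
  ∧E₁  : ∀ {n} {Γ : List (Formula n)} {φ ψ} → Γ ⊢ φ ∧' ψ → Γ ⊢ φ
  ∧E₂  : ∀ {n} {Γ : List (Formula n)} {φ ψ} → Γ ⊢ φ ∧' ψ → Γ ⊢ ψ
  ∨I₁  : ∀ {n} {Γ : List (Formula n)} {φ ψ} → Γ ⊢ φ → Γ ⊢ φ ∨' ψ
  ∨I₂  : ∀ {n} {Γ : List (Formula n)} {φ ψ} → Γ ⊢ ψ → Γ ⊢ φ ∨' ψ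
  ∨E   : ∀ {n} {Γ : List (Formula n)} {φ ψ χ} →
         Γ ⊢ φ ∨' ψ → (φ ∷ Γ) ⊢ χ → (ψ ∷ Γ) ⊢ χ → Γ ⊢ χ
  ∀I   : ∀ {n} {Γ : List (Formula n)} {φ} → map wkF Γ ⊢ φ → Γ ⊢ ∀' φ
  ∀E   : ∀ {n} {Γ : List (Formula n)} {φ} (t : Term n) → Γ ⊢ ∀' φ → Γ ⊢ φ [ t ]
  ∃I   : ∀ {n} {Γ : List (Formula n)} {φ} (t : Term n) → Γ ⊢ φ [ t ] → Γ ⊢ ∃' φ
  ∃E   : ∀ {n} {Γ : List (Formula n)} {φ ψ} →
         Γ ⊢ ∃' φ → (φ ∷ map wkF Γ) ⊢ wkF ψ → Γ ⊢ ψ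
  ≐refl : ∀ {n} {Γ : List (Formula n)} (t : Term n) → Γ ⊢ t ≐ t
  ≐subst : ∀ {n} {Γ : List (Formula n)} (φ : Formula (suc n)) {s t : Term n} →
           Γ ⊢ s ≐ t → Γ ⊢ φ [ s ] → Γ ⊢ φ [ t ]

private
  x₀ : ∀ {n} → Term (suc n)
  x₀ = var zero
  x₁ : ∀ {n} → Term (suc (suc n))
  x₁ = var (suc zero)
  x₂ : ∀ {n} → Term (suc (suc (suc n)))
  x₂ = var (suc (suc zero))

-- In axioms with several variables, x is the outermost-bound variable.
ax1 ax2 ax3 ax4 ax5 ax6 ax7 : Sentence
ax1 = ∀' (x₀ ≐ e ∙ x₀ ∧' x₀ ≐ x₀ ∙ e)
ax2 = ∀' (∀' (∀' ((x₂ ∙ x₁) ∙ x₀ ≐ x₂ ∙ (x₁ ∙ x₀))))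
ax3 = ∀' (∀' (¬' (x₁ ≐ x₀) ⇒ (¬' (x₁ ∙ 0̇ ≐ x₀ ∙ 0̇) ∧' ¬' (x₁ ∙ 1̇ ≐ x₀ ∙ 1̇))))
ax4 = ∀' (∀' (¬' (x₁ ∙ 0̇ ≐ x₀ ∙ 1̇)))
ax5 = ∀' (x₀ ⊑ e ⇔ x₀ ≐ e)
ax6 = ∀' (x₀ ⊑ 0̇ ⇔ (x₀ ≐ e ∨' x₀ ≐ 0̇))
ax7 = ∀' (x₀ ⊑ 1̇ ⇔ (x₀ ≐ e ∨' x₀ ≐ 1̇))

-- axioms (8)-(11), a, b ∈ {0,1}; x = x₁, y = x₀; ayb read as (a∙y)∙b
axab : Term 0 → Term 0 → Sentence
axab a b = ∀' (∀' (x₁ ⊑ (wkT (wkT a) ∙ x₀) ∙ wkT (wkT b) ⇔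
  (x₁ ≐ (wkT (wkT a) ∙ x₀) ∙ wkT (wkT b)
   ∨' x₁ ⊑ wkT (wkT a) ∙ x₀
   ∨' x₁ ⊑ x₀ ∙ wkT (wkT b))))

BAxioms : List Sentence
BAxioms = ax1 ∷ ax2 ∷ ax3 ∷ ax4 ∷ ax5 ∷ ax6 ∷ ax7 ∷
  axab 0̇ 0̇ ∷ axab 0̇ 1̇ ∷ axab 1̇ 0̇ ∷ axab 1̇ 1̇ ∷ []

B⊢ : Sentence → Set
B⊢ φ = BAxioms ⊢ φ

-- Induct on the Σ-formula, instantiating its free variables by numerals. B proves that
-- every closed term equals the numeral of its value and, by axioms (3) and (4), that
-- numerals of distinct strings differ. Axioms (5)-(11) show that x ⊑ ⌜γ⌝ holds exactly
-- for the numerals of the substrings of γ, so bounded quantifiers become finite case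
-- splits; an unbounded ∃ is witnessed by the numeral of a true witness.
module Submission where

open import Defs
open import Data.Nat using (ℕ; suc)
open import Data.Fin using (Fin; zero; suc; #_)
open import Data.List using (List; []; _∷_; _++_; map; reverse; length; lookup; initLast; _∷ʳ′_)
open import Data.List.Properties using (reverse-++; reverse-injective; ∷-injectiveʳ; ++-identityʳ; ++-assoc; ∷ʳ-injectiveˡ)
open import Data.List.Membership.Propositional.Properties using (∈-map⁺; ∈-lookup)
open import Data.List.Relation.Binary.Subset.Propositional using (_⊆_)
open import Data.List.Relation.Binary.Subset.Propositional.Properties using (⊆-refl; map⁺)
open import Data.List.Relation.Unary.Any using (here; there)
open import Data.Product using (_,_)
open import Data.Sum using (_⊎_; inj₁; inj₂)
open import Data.Empty using (⊥-elim)
open import Function using (_∘_)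
open import Relation.Binary.PropositionalEquality using (_≡_; _≢_; refl; sym; trans; cong; cong₂; subst; subst₂)

sub0-wkT : ∀ {n} (u t : Term n) → subT (sub0 u) (wkT t) ≡ t
sub0-wkT u (var i) = refl
sub0-wkT u e = refl
sub0-wkT u 0̇ = refl
sub0-wkT u 1̇ = refl
sub0-wkT u (s ∙ t) = cong₂ _∙_ (sub0-wkT u s) (sub0-wkT u t)

subT-extS-wkT : ∀ {m n} (τ : Sub m n) t → subT (extS τ) (wkT t) ≡ wkT (subT τ t)
subT-extS-wkT τ (var i) = refl
subT-extS-wkT τ e = refl
subT-extS-wkT τ 0̇ = refl
subT-extS-wkT τ 1̇ = refl
subT-extS-wkT τ (s ∙ t) = cong₂ _∙_ (subT-extS-wkT τ s) (subT-extS-wkT τ t)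

subT-cong : ∀ {m n} {σ τ : Sub m n} → (∀ i → σ i ≡ τ i) → ∀ t → subT σ t ≡ subT τ t
subT-cong eq (var i) = eq i
subT-cong eq e = refl
subT-cong eq 0̇ = refl
subT-cong eq 1̇ = refl
subT-cong eq (s ∙ t) = cong₂ _∙_ (subT-cong eq s) (subT-cong eq t)

extS-cong : ∀ {m n} {σ τ : Sub m n} → (∀ i → σ i ≡ τ i) → ∀ i → extS σ i ≡ extS τ i
extS-cong eq zero = refl
extS-cong eq (suc i) = cong wkT (eq i)

subF-cong : ∀ {m n} {σ τ : Sub m n} → (∀ i → σ i ≡ τ i) → ∀ φ → subF σ φ ≡ subF τ φ
subF-cong eq (s ⊑ t) = cong₂ _⊑_ (subT-cong eq s) (subT-cong eq t)
subF-cong eq (s ≐ t) = cong₂ _≐_ (subT-cong eq s) (subT-cong eq t)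
subF-cong eq ⊥' = refl
subF-cong eq (φ ⇒ ψ) = cong₂ _⇒_ (subF-cong eq φ) (subF-cong eq ψ)
subF-cong eq (φ ∧' ψ) = cong₂ _∧'_ (subF-cong eq φ) (subF-cong eq ψ)
subF-cong eq (φ ∨' ψ) = cong₂ _∨'_ (subF-cong eq φ) (subF-cong eq ψ)
subF-cong eq (∀' φ) = cong ∀' (subF-cong (extS-cong eq) φ)
subF-cong eq (∃' φ) = cong ∃' (subF-cong (extS-cong eq) φ)

subT-subT : ∀ {k m n} (τ : Sub m n) (σ : Sub k m) t → subT τ (subT σ t) ≡ subT (λ i → subT τ (σ i)) t
subT-subT τ σ (var i) = refl
subT-subT τ σ e = refl
subT-subT τ σ 0̇ = refl
subT-subT τ σ 1̇ = refl
subT-subT τ σ (s ∙ t) = cong₂ _∙_ (subT-subT τ σ s) (subT-subT τ σ t)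

extS-subT : ∀ {k m n} (τ : Sub m n) (σ : Sub k m) i →
            subT (extS τ) (extS σ i) ≡ extS (λ j → subT τ (σ j)) i
extS-subT τ σ zero = refl
extS-subT τ σ (suc i) = subT-extS-wkT τ (σ i)

subF-subF : ∀ {k m n} (τ : Sub m n) (σ : Sub k m) φ → subF τ (subF σ φ) ≡ subF (λ i → subT τ (σ i)) φ
subF-subF τ σ (s ⊑ t) = cong₂ _⊑_ (subT-subT τ σ s) (subT-subT τ σ t)
subF-subF τ σ (s ≐ t) = cong₂ _≐_ (subT-subT τ σ s) (subT-subT τ σ t)
subF-subF τ σ ⊥' = refl
subF-subF τ σ (φ ⇒ ψ) = cong₂ _⇒_ (subF-subF τ σ φ) (subF-subF τ σ ψ)
subF-subF τ σ (φ ∧' ψ) = cong₂ _∧'_ (subF-subF τ σ φ) (subF-subF τ σ ψ)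
subF-subF τ σ (φ ∨' ψ) = cong₂ _∨'_ (subF-subF τ σ φ) (subF-subF τ σ ψ)
subF-subF τ σ (∀' φ) = cong ∀' (trans (subF-subF (extS τ) (extS σ) φ) (subF-cong (extS-subT τ σ) φ))
subF-subF τ σ (∃' φ) = cong ∃' (trans (subF-subF (extS τ) (extS σ) φ) (subF-cong (extS-subT τ σ) φ))

subT-id : ∀ {n} {σ : Sub n n} → (∀ i → σ i ≡ var i) → ∀ t → subT σ t ≡ t
subT-id eq (var i) = eq i
subT-id eq e = refl
subT-id eq 0̇ = refl
subT-id eq 1̇ = refl
subT-id eq (s ∙ t) = cong₂ _∙_ (subT-id eq s) (subT-id eq t)

extS-id : ∀ {n} {σ : Sub n n} → (∀ i → σ i ≡ var i) → ∀ i → extS σ i ≡ var i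
extS-id eq zero = refl
extS-id eq (suc i) = cong wkT (eq i)

subF-id : ∀ {n} {σ : Sub n n} → (∀ i → σ i ≡ var i) → ∀ φ → subF σ φ ≡ φ
subF-id eq (s ⊑ t) = cong₂ _⊑_ (subT-id eq s) (subT-id eq t)
subF-id eq (s ≐ t) = cong₂ _≐_ (subT-id eq s) (subT-id eq t)
subF-id eq ⊥' = refl
subF-id eq (φ ⇒ ψ) = cong₂ _⇒_ (subF-id eq φ) (subF-id eq ψ)
subF-id eq (φ ∧' ψ) = cong₂ _∧'_ (subF-id eq φ) (subF-id eq ψ)
subF-id eq (φ ∨' ψ) = cong₂ _∨'_ (subF-id eq φ) (subF-id eq ψ)
subF-id eq (∀' φ) = cong ∀' (subF-id (extS-id eq) φ)
subF-id eq (∃' φ) = cong ∃' (subF-id (extS-id eq) φ)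

infixr 5 _∷ˢ_
_∷ˢ_ : ∀ {m n} → Term n → Sub m n → Sub (suc m) n
(u ∷ˢ τ) zero = u
(u ∷ˢ τ) (suc i) = τ i

subF-extS-[] : ∀ {m n} (τ : Sub m n) (u : Term n) φ → subF (extS τ) φ [ u ] ≡ subF (u ∷ˢ τ) φ
subF-extS-[] τ u φ = trans (subF-subF (sub0 u) (extS τ) φ) (subF-cong pointwise φ)
  where
  pointwise : ∀ i → subT (sub0 u) (extS τ i) ≡ (u ∷ˢ τ) i
  pointwise zero = refl
  pointwise (suc i) = sub0-wkT u (τ i)

⟦⟧-wkT : ∀ {n} (t : Term n) x (α : Env n) → ⟦ wkT t ⟧ (x ∷ᵉ α) ≡ ⟦ t ⟧ α
⟦⟧-wkT (var i) x α = refl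
⟦⟧-wkT e x α = refl
⟦⟧-wkT 0̇ x α = refl
⟦⟧-wkT 1̇ x α = refl
⟦⟧-wkT (s ∙ t) x α = cong₂ _++_ (⟦⟧-wkT s x α) (⟦⟧-wkT t x α)

bit : ∀ {n} → Bit → Term n
bit 𝟎 = 0̇
bit 𝟏 = 1̇

-- The numeral of b₁…bₖ is (…((e b₁) b₂)…) bₖ. It is built from the reversed
-- string so that recursion peels off the last bit, the one axioms (3) and (4) see.
numeralʳ : ∀ {n} → BitString → Term n
numeralʳ [] = e
numeralʳ (b ∷ r) = numeralʳ r ∙ bit b

⌜_⌝ : ∀ {n} → BitString → Term n
⌜ β ⌝ = numeralʳ (reverse β)

numerals : ∀ {k n} → Env k → Sub k n
numerals α i = ⌜ α i ⌝

⌜⌝-∷ʳ : ∀ {n} δ b → ⌜_⌝ {n} (δ ++ b ∷ []) ≡ ⌜ δ ⌝ ∙ bit b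
⌜⌝-∷ʳ δ b = cong numeralʳ (reverse-++ δ (b ∷ []))

renT-bit : ∀ {m n} (ρ : Ren m n) b → renT ρ (bit b) ≡ bit b
renT-bit ρ 𝟎 = refl
renT-bit ρ 𝟏 = refl

renT-numeralʳ : ∀ {m n} (ρ : Ren m n) r → renT ρ (numeralʳ r) ≡ numeralʳ r
renT-numeralʳ ρ [] = refl
renT-numeralʳ ρ (b ∷ r) = cong₂ _∙_ (renT-numeralʳ ρ r) (renT-bit ρ b)

renT-⌜⌝ : ∀ {m n} (ρ : Ren m n) β → renT ρ ⌜ β ⌝ ≡ ⌜ β ⌝
renT-⌜⌝ ρ β = renT-numeralʳ ρ (reverse β)

renT-subT-numerals : ∀ {k m n} (ρ : Ren m n) (α : Env k) t →
                     renT ρ (subT (numerals α) t) ≡ subT (numerals α) t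
renT-subT-numerals ρ α (var i) = renT-⌜⌝ ρ (α i)
renT-subT-numerals ρ α e = refl
renT-subT-numerals ρ α 0̇ = refl
renT-subT-numerals ρ α 1̇ = refl
renT-subT-numerals ρ α (s ∙ t) = cong₂ _∙_ (renT-subT-numerals ρ α s) (renT-subT-numerals ρ α t)

extS-numerals-[⌜⌝] : ∀ {k n} (α : Env k) x φ →
                     subF (extS (numerals {n = n} α)) φ [ ⌜ x ⌝ ] ≡ subF (numerals (x ∷ᵉ α)) φ
extS-numerals-[⌜⌝] α x φ = trans (subF-extS-[] (numerals α) ⌜ x ⌝ φ) (subF-cong pointwise φ)
  where
  pointwise : ∀ i → (⌜ x ⌝ ∷ˢ numerals α) i ≡ numerals (x ∷ᵉ α) i
  pointwise zero = refl
  pointwise (suc i) = refl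

extS-numerals-[var0] : ∀ {k n} (α : Env k) φ →
                       subF (extS (numerals {n = suc n} α)) φ [ var zero ] ≡ subF (extS (numerals α)) φ
extS-numerals-[var0] α φ = trans (subF-extS-[] (numerals α) (var zero) φ) (subF-cong pointwise φ)
  where
  pointwise : ∀ i → (var zero ∷ˢ numerals α) i ≡ extS (numerals α) i
  pointwise zero = refl
  pointwise (suc i) = sym (renT-⌜⌝ suc (α i))

↑ : ∀ {n} → Sentence → Formula n
↑ = renF (λ ())

-- On the concrete closed axioms ↑ and wkF compute away: map ↑ BAxioms is BAxioms in
-- scope 0, and map wkF maps it to itself.
HasAx : ∀ {n} → List (Formula n) → Set
HasAx Γ = map ↑ BAxioms ⊆ Γ

-- Axiom (k) of the paper is  axiom H (# (k - 1)).
axiom : ∀ {n} {Γ : List (Formula n)} → HasAx Γ → (i : Fin (length BAxioms)) → Γ ⊢ ↑ (lookup BAxioms i)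
axiom H i = hyp (H (∈-map⁺ ↑ (∈-lookup i)))

module _ {n : ℕ} {Γ : List (Formula n)} where

  leibniz : (χ : Formula (suc n)) {s t : Term n} {A B : Formula n} →
            χ [ s ] ≡ A → χ [ t ] ≡ B → Γ ⊢ s ≐ t → Γ ⊢ A → Γ ⊢ B
  leibniz χ refl refl = ≐subst χ

  ≐-sym : {s t : Term n} → Γ ⊢ s ≐ t → Γ ⊢ t ≐ s
  ≐-sym {s} {t} s≐t =
    leibniz (var zero ≐ wkT s) (cong (s ≐_) (sub0-wkT s s)) (cong (t ≐_) (sub0-wkT t s)) s≐t (≐refl s)

  ≐-trans : {s t u : Term n} → Γ ⊢ s ≐ t → Γ ⊢ t ≐ u → Γ ⊢ s ≐ u
  ≐-trans {s} {t} {u} s≐t t≐u =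
    leibniz (wkT s ≐ var zero) (cong (_≐ t) (sub0-wkT t s)) (cong (_≐ u) (sub0-wkT u s)) t≐u s≐t

  ∙-congʳ : {s s′ u : Term n} → Γ ⊢ s ≐ s′ → Γ ⊢ s ∙ u ≐ s′ ∙ u
  ∙-congʳ {s} {s′} {u} s≐s′ = leibniz (wkT s ∙ wkT u ≐ var zero ∙ wkT u)
    (cong₂ _≐_ (cong₂ _∙_ (sub0-wkT s s) (sub0-wkT s u)) (cong (s ∙_) (sub0-wkT s u)))
    (cong₂ _≐_ (cong₂ _∙_ (sub0-wkT s′ s) (sub0-wkT s′ u)) (cong (s′ ∙_) (sub0-wkT s′ u))) s≐s′ (≐refl (s ∙ u))

  ∙-congˡ : {s s′ u : Term n} → Γ ⊢ s ≐ s′ → Γ ⊢ u ∙ s ≐ u ∙ s′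
  ∙-congˡ {s} {s′} {u} s≐s′ = leibniz (wkT u ∙ wkT s ≐ wkT u ∙ var zero)
    (cong₂ _≐_ (cong₂ _∙_ (sub0-wkT s u) (sub0-wkT s s)) (cong (_∙ s) (sub0-wkT s u)))
    (cong₂ _≐_ (cong₂ _∙_ (sub0-wkT s′ u) (sub0-wkT s′ s)) (cong (_∙ s′) (sub0-wkT s′ u))) s≐s′ (≐refl (u ∙ s))

  ⊑-respˡ-≐ : {s s′ u : Term n} → Γ ⊢ s ≐ s′ → Γ ⊢ s ⊑ u → Γ ⊢ s′ ⊑ u
  ⊑-respˡ-≐ {s} {s′} {u} = leibniz (var zero ⊑ wkT u) (cong (s ⊑_) (sub0-wkT s u)) (cong (s′ ⊑_) (sub0-wkT s′ u))

  ⊑-respʳ-≐ : {s s′ u : Term n} → Γ ⊢ s ≐ s′ → Γ ⊢ u ⊑ s → Γ ⊢ u ⊑ s′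
  ⊑-respʳ-≐ {s} {s′} {u} = leibniz (wkT u ⊑ var zero) (cong (_⊑ s) (sub0-wkT s u)) (cong (_⊑ s′) (sub0-wkT s′ u))

  ⇔-⇒ : {A B : Formula n} → Γ ⊢ A ⇔ B → Γ ⊢ A → Γ ⊢ B
  ⇔-⇒ A⇔B = ⇒E (∧E₁ A⇔B)

  ⇔-⇐ : {A B : Formula n} → Γ ⊢ A ⇔ B → Γ ⊢ B → Γ ⊢ A
  ⇔-⇐ A⇔B = ⇒E (∧E₂ A⇔B)

module _ {n : ℕ} {Γ : List (Formula n)} (H : HasAx Γ) where

  e-identityˡ : (t : Term n) → Γ ⊢ t ≐ e ∙ t
  e-identityˡ t = ∧E₁ (∀E t (axiom H (# 0)))

  e-identityʳ : (t : Term n) → Γ ⊢ t ≐ t ∙ e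
  e-identityʳ t = ∧E₂ (∀E t (axiom H (# 0)))

  ∙-assoc : (x y z : Term n) → Γ ⊢ (x ∙ y) ∙ z ≐ x ∙ (y ∙ z)
  ∙-assoc x y z = subst₂ (λ X Y → Γ ⊢ (X ∙ Y) ∙ z ≐ X ∙ (Y ∙ z))
    (trans (cong (subT (sub0 z)) (trans (subT-extS-wkT (sub0 y) (wkT x)) (cong wkT (sub0-wkT y x))))
           (sub0-wkT z x))
    (sub0-wkT z y)
    (∀E z (∀E y (∀E x (axiom H (# 1)))))

  private
    axiom3 : (x y : Term n) → Γ ⊢ ¬' (x ≐ y) ⇒ (¬' (x ∙ 0̇ ≐ y ∙ 0̇) ∧' ¬' (x ∙ 1̇ ≐ y ∙ 1̇))
    axiom3 x y = subst (λ X → Γ ⊢ ¬' (X ≐ y) ⇒ (¬' (X ∙ 0̇ ≐ y ∙ 0̇) ∧' ¬' (X ∙ 1̇ ≐ y ∙ 1̇)))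
                       (sub0-wkT y x) (∀E y (∀E x (axiom H (# 2))))

  ∙bit-≉ : (c : Bit) (x y : Term n) → Γ ⊢ ¬' (x ≐ y) → Γ ⊢ ¬' (x ∙ bit c ≐ y ∙ bit c)
  ∙bit-≉ 𝟎 x y x≉y = ∧E₁ (⇒E (axiom3 x y) x≉y)
  ∙bit-≉ 𝟏 x y x≉y = ∧E₂ (⇒E (axiom3 x y) x≉y)

  ∙0≉∙1 : (x y : Term n) → Γ ⊢ ¬' (x ∙ 0̇ ≐ y ∙ 1̇)
  ∙0≉∙1 x y = subst (λ X → Γ ⊢ ¬' (X ∙ 0̇ ≐ y ∙ 1̇)) (sub0-wkT y x) (∀E y (∀E x (axiom H (# 3))))

  ⊑e⇔ : (x : Term n) → Γ ⊢ x ⊑ e ⇔ x ≐ e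
  ⊑e⇔ x = ∀E x (axiom H (# 4))

  ⊑bit⇔ : (c : Bit) (x : Term n) → Γ ⊢ x ⊑ bit c ⇔ (x ≐ e ∨' x ≐ bit c)
  ⊑bit⇔ 𝟎 x = ∀E x (axiom H (# 5))
  ⊑bit⇔ 𝟏 x = ∀E x (axiom H (# 6))

  private
    ⊑-inner-body : Bit → Bit → Term n → Term n → Formula n
    ⊑-inner-body a b x y =
      x ⊑ (bit a ∙ y) ∙ bit b ⇔ (x ≐ (bit a ∙ y) ∙ bit b ∨' x ⊑ bit a ∙ y ∨' x ⊑ y ∙ bit b)

  ⊑-inner⇔ : (a b : Bit) (x y : Term n) →
             Γ ⊢ x ⊑ (bit a ∙ y) ∙ bit b ⇔ (x ≐ (bit a ∙ y) ∙ bit b ∨' x ⊑ bit a ∙ y ∨' x ⊑ y ∙ bit b)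
  ⊑-inner⇔ a b x y = subst (λ X → Γ ⊢ ⊑-inner-body a b X y) (sub0-wkT y x) (instantiate a b)
    where
    instantiate : (a b : Bit) → Γ ⊢ ⊑-inner-body a b (subT (sub0 y) (wkT x)) y
    instantiate 𝟎 𝟎 = ∀E y (∀E x (axiom H (# 7)))
    instantiate 𝟎 𝟏 = ∀E y (∀E x (axiom H (# 8)))
    instantiate 𝟏 𝟎 = ∀E y (∀E x (axiom H (# 9)))
    instantiate 𝟏 𝟏 = ∀E y (∀E x (axiom H (# 10)))

  numeralʳ-++ : ∀ r s → Γ ⊢ numeralʳ (r ++ s) ≐ numeralʳ s ∙ numeralʳ r
  numeralʳ-++ [] s = e-identityʳ (numeralʳ s)
  numeralʳ-++ (b ∷ r) s = ≐-trans (∙-congʳ (numeralʳ-++ r s)) (∙-assoc (numeralʳ s) (numeralʳ r) (bit b))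

  ⌜⌝-++ : ∀ β γ → Γ ⊢ ⌜ β ++ γ ⌝ ≐ ⌜ β ⌝ ∙ ⌜ γ ⌝
  ⌜⌝-++ β γ = subst (λ r → Γ ⊢ numeralʳ r ≐ ⌜ β ⌝ ∙ ⌜ γ ⌝) (sym (reverse-++ β γ))
                    (numeralʳ-++ (reverse γ) (reverse β))

  ⌜⌝-∷ : ∀ c β → Γ ⊢ ⌜ c ∷ β ⌝ ≐ bit c ∙ ⌜ β ⌝
  ⌜⌝-∷ c β = ≐-trans (⌜⌝-++ (c ∷ []) β) (∙-congʳ (≐-sym (e-identityˡ (bit c))))

  ⌜⌝-inner : ∀ a δ b → Γ ⊢ ⌜ a ∷ δ ++ b ∷ [] ⌝ ≐ (bit a ∙ ⌜ δ ⌝) ∙ bit b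
  ⌜⌝-inner a δ b = subst (λ t → Γ ⊢ t ≐ (bit a ∙ ⌜ δ ⌝) ∙ bit b) (sym (⌜⌝-∷ʳ (a ∷ δ) b)) (∙-congʳ (⌜⌝-∷ a δ))

  ⌜⟦⟧⌝ : ∀ {k} (t : Term k) (α : Env k) → Γ ⊢ subT (numerals α) t ≐ ⌜ ⟦ t ⟧ α ⌝
  ⌜⟦⟧⌝ (var i) α = ≐refl _
  ⌜⟦⟧⌝ e α = ≐refl e
  ⌜⟦⟧⌝ 0̇ α = e-identityˡ 0̇
  ⌜⟦⟧⌝ 1̇ α = e-identityˡ 1̇
  ⌜⟦⟧⌝ (s ∙ t) α = ≐-trans (≐-trans (∙-congʳ (⌜⟦⟧⌝ s α)) (∙-congˡ (⌜⟦⟧⌝ t α)))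
                           (≐-sym (⌜⌝-++ (⟦ s ⟧ α) (⟦ t ⟧ α)))

-- From e = y0 we get 1 = 1e = (1y)0, contradicting 1 = e1 by axiom (4); dually for e = y1.
e≉∙bit : ∀ {n} {Γ : List (Formula n)} → HasAx Γ → ∀ y c → Γ ⊢ ¬' (e ≐ y ∙ bit c)
e≉∙bit {Γ = Γ} H y 𝟎 = ⇒I (⇒E (∙0≉∙1 H′ (1̇ ∙ y) e) (≐-trans (≐-sym 1≐[1y]0) (e-identityˡ H′ 1̇)))
  where
  H′ : HasAx (e ≐ y ∙ 0̇ ∷ Γ)
  H′ = there ∘ H
  1≐[1y]0 : (e ≐ y ∙ 0̇ ∷ Γ) ⊢ 1̇ ≐ (1̇ ∙ y) ∙ 0̇
  1≐[1y]0 = ≐-trans (e-identityʳ H′ 1̇) (≐-trans (∙-congˡ (hyp (here refl))) (≐-sym (∙-assoc H′ 1̇ y 0̇)))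
e≉∙bit {Γ = Γ} H y 𝟏 = ⇒I (⇒E (∙0≉∙1 H′ e (0̇ ∙ y)) (≐-trans (≐-sym (e-identityˡ H′ 0̇)) 0≐[0y]1))
  where
  H′ : HasAx (e ≐ y ∙ 1̇ ∷ Γ)
  H′ = there ∘ H
  0≐[0y]1 : (e ≐ y ∙ 1̇ ∷ Γ) ⊢ 0̇ ≐ (0̇ ∙ y) ∙ 1̇
  0≐[0y]1 = ≐-trans (e-identityʳ H′ 0̇) (≐-trans (∙-congˡ (hyp (here refl))) (≐-sym (∙-assoc H′ 0̇ y 1̇)))

numeralʳ-≉ : ∀ {n} {Γ : List (Formula n)} → HasAx Γ → ∀ r s → r ≢ s → Γ ⊢ ¬' (numeralʳ r ≐ numeralʳ s)
numeralʳ-≉ H [] [] r≢s = ⊥-elim (r≢s refl)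
numeralʳ-≉ H [] (c ∷ s) r≢s = e≉∙bit H (numeralʳ s) c
numeralʳ-≉ H (c ∷ r) [] r≢s = ⇒I (⇒E (e≉∙bit (there ∘ H) (numeralʳ r) c) (≐-sym (hyp (here refl))))
numeralʳ-≉ H (𝟎 ∷ r) (𝟏 ∷ s) r≢s = ∙0≉∙1 H (numeralʳ r) (numeralʳ s)
numeralʳ-≉ H (𝟏 ∷ r) (𝟎 ∷ s) r≢s =
  ⇒I (⇒E (∙0≉∙1 (there ∘ H) (numeralʳ s) (numeralʳ r)) (≐-sym (hyp (here refl))))
numeralʳ-≉ H (𝟎 ∷ r) (𝟎 ∷ s) r≢s = ∙bit-≉ H 𝟎 _ _ (numeralʳ-≉ H r s (r≢s ∘ cong (𝟎 ∷_)))
numeralʳ-≉ H (𝟏 ∷ r) (𝟏 ∷ s) r≢s = ∙bit-≉ H 𝟏 _ _ (numeralʳ-≉ H r s (r≢s ∘ cong (𝟏 ∷_)))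

⌜⌝-≉ : ∀ {n} {Γ : List (Formula n)} {β γ} → HasAx Γ → β ≢ γ → Γ ⊢ ¬' (⌜ β ⌝ ≐ ⌜ γ ⌝)
⌜⌝-≉ {β = β} {γ} H β≢γ = numeralʳ-≉ H (reverse β) (reverse γ) (β≢γ ∘ reverse-injective)

≼-refl : ∀ {β} → β ≼ β
≼-refl {β} = [] , [] , ++-identityʳ β

≼-trans : ∀ {β γ δ} → β ≼ γ → γ ≼ δ → β ≼ δ
≼-trans {β} (g₁ , d₁ , refl) (g₂ , d₂ , refl) = g₂ ++ g₁ , d₁ ++ d₂ , trans (++-assoc g₂ g₁ _)
  (cong (g₂ ++_) (sym (trans (++-assoc g₁ (β ++ d₁) d₂) (cong (g₁ ++_) (++-assoc β d₁ d₂)))))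

xs≼xs++ys : ∀ xs ys → xs ≼ (xs ++ ys)
xs≼xs++ys xs ys = [] , ys , refl

ys≼xs++ys : ∀ xs ys → ys ≼ (xs ++ ys)
ys≼xs++ys xs ys = xs , [] , cong (xs ++_) (++-identityʳ ys)

≼[]⇒≡[] : ∀ {β} → β ≼ [] → β ≡ []
≼[]⇒≡[] {[]} _ = refl
≼[]⇒≡[] {_ ∷ _} ([] , _ , ())
≼[]⇒≡[] {_ ∷ _} (_ ∷ _ , _ , ())

≼-single : ∀ {β c} → β ≼ (c ∷ []) → β ≡ [] ⊎ β ≡ c ∷ []
≼-single {[]} _ = inj₁ refl
≼-single {_ ∷ []} ([] , [] , refl) = inj₂ refl
≼-single {_ ∷ []} ([] , _ ∷ _ , ())
≼-single {_ ∷ _ ∷ _} ([] , _ , ())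
≼-single {_ ∷ _} (_ ∷ [] , _ , ())
≼-single {_ ∷ _} (_ ∷ _ ∷ _ , _ , ())

≼-inner : ∀ {β} a δ b → β ≼ (a ∷ δ ++ b ∷ []) →
          β ≡ a ∷ δ ++ b ∷ [] ⊎ β ≼ (a ∷ δ) ⊎ β ≼ (δ ++ b ∷ [])
≼-inner a δ b (_ ∷ g , d , eq) = inj₂ (inj₂ (g , d , ∷-injectiveʳ eq))
≼-inner {β} a δ b ([] , d , eq) with initLast d
... | [] = inj₁ (trans (sym (++-identityʳ β)) eq)
... | d′ ∷ʳ′ b′ = inj₂ (inj₁ ([] , d′ , ∷ʳ-injectiveˡ (β ++ d′) (a ∷ δ) (trans (++-assoc β d′ (b′ ∷ [])) eq)))

-- The recursion scheme of axioms (5)-(11).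
data EndsView : BitString → Set where
  empty  : EndsView []
  single : ∀ c → EndsView (c ∷ [])
  inner  : ∀ a δ b → EndsView (a ∷ δ) → EndsView (δ ++ b ∷ []) → EndsView (a ∷ δ ++ b ∷ [])

consView : ∀ c {γ} → EndsView γ → EndsView (c ∷ γ)
consView c empty = single c
consView c (single d) = inner c [] d (single c) (single d)
consView c (inner a δ b v₁ v₂) = inner c (a ∷ δ) b (consView c v₁) (inner a δ b v₁ v₂)

endsView : ∀ γ → EndsView γ
endsView [] = empty
endsView (c ∷ γ) = consView c (endsView γ)

⌜⌝-⊑ : ∀ {n} {Γ : List (Formula n)} {β γ} → HasAx Γ → EndsView γ → β ≼ γ → Γ ⊢ ⌜ β ⌝ ⊑ ⌜ γ ⌝
⌜⌝-⊑ H empty β≼[] rewrite ≼[]⇒≡[] β≼[] = ⇔-⇐ (⊑e⇔ H e) (≐refl e)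
⌜⌝-⊑ H (single c) β≼c with ≼-single β≼c
... | inj₁ refl = ⊑-respʳ-≐ (e-identityˡ H (bit c)) (⇔-⇐ (⊑bit⇔ H c e) (∨I₁ (≐refl e)))
... | inj₂ refl = ⊑-respˡ-≐ c≐ec (⊑-respʳ-≐ c≐ec (⇔-⇐ (⊑bit⇔ H c (bit c)) (∨I₂ (≐refl (bit c)))))
  where c≐ec = e-identityˡ H (bit c)
⌜⌝-⊑ {Γ = Γ} {β} H (inner a δ b v₁ v₂) β≼ =
  ⊑-respʳ-≐ (≐-sym (⌜⌝-inner H a δ b)) (⇔-⇐ (⊑-inner⇔ H a b ⌜ β ⌝ ⌜ δ ⌝) (cases (≼-inner a δ b β≼)))
  where
  cases : β ≡ a ∷ δ ++ b ∷ [] ⊎ β ≼ (a ∷ δ) ⊎ β ≼ (δ ++ b ∷ []) →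
          Γ ⊢ ⌜ β ⌝ ≐ (bit a ∙ ⌜ δ ⌝) ∙ bit b ∨' ⌜ β ⌝ ⊑ bit a ∙ ⌜ δ ⌝ ∨' ⌜ β ⌝ ⊑ ⌜ δ ⌝ ∙ bit b
  cases (inj₁ refl) = ∨I₁ (⌜⌝-inner H a δ b)
  cases (inj₂ (inj₁ β≼aδ)) = ∨I₂ (∨I₁ (⊑-respʳ-≐ (⌜⌝-∷ H a δ) (⌜⌝-⊑ H v₁ β≼aδ)))
  cases (inj₂ (inj₂ β≼δb)) = ∨I₂ (∨I₂ (subst (λ t → Γ ⊢ ⌜ β ⌝ ⊑ t) (⌜⌝-∷ʳ δ b) (⌜⌝-⊑ H v₂ β≼δb)))

-- Axioms (5)-(11) make  x ⊑ ⌜γ⌝  the finite disjunction of  x = ⌜δ⌝  over the substrings δ of γ.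
-- The continuation must work in every extension of Γ, since the case split adds hypotheses.
⊑⌜⌝-cases : ∀ {n} {Γ : List (Formula n)} {x χ γ} → HasAx Γ → EndsView γ → Γ ⊢ x ⊑ ⌜ γ ⌝ →
            (∀ {Δ δ} → Γ ⊆ Δ → δ ≼ γ → Δ ⊢ x ≐ ⌜ δ ⌝ → Δ ⊢ χ) → Γ ⊢ χ
⊑⌜⌝-cases H empty x⊑ k = k ⊆-refl ≼-refl (⇔-⇒ (⊑e⇔ H _) x⊑)
⊑⌜⌝-cases H (single c) x⊑ k =
  ∨E (⇔-⇒ (⊑bit⇔ H c _) (⊑-respʳ-≐ (≐-sym (e-identityˡ H (bit c))) x⊑))
     (k there (xs≼xs++ys [] _) (hyp (here refl)))
     (k there ≼-refl (≐-trans (hyp (here refl)) (e-identityˡ (there ∘ H) (bit c))))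
⊑⌜⌝-cases {Γ = Γ} {x} H (inner a δ b v₁ v₂) x⊑ k =
  ∨E (⇔-⇒ (⊑-inner⇔ H a b x ⌜ δ ⌝) (⊑-respʳ-≐ (⌜⌝-inner H a δ b) x⊑))
     (k there ≼-refl (≐-trans (hyp (here refl)) (≐-sym (⌜⌝-inner (there ∘ H) a δ b))))
     (∨E (hyp (here refl))
       (⊑⌜⌝-cases H₂ v₁ (⊑-respʳ-≐ (≐-sym (⌜⌝-∷ H₂ a δ)) (hyp (here refl)))
         λ ⊆Δ δ′≼ → k (⊆Δ ∘ there ∘ there) (≼-trans δ′≼ (xs≼xs++ys (a ∷ δ) (b ∷ []))))
       (⊑⌜⌝-cases H₂ v₂ x⊑⌜δb⌝
         λ ⊆Δ δ′≼ → k (⊆Δ ∘ there ∘ there) (≼-trans δ′≼ (ys≼xs++ys (a ∷ []) (δ ++ b ∷ [])))))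
  where
  H₂ : ∀ {A B} → HasAx (A ∷ B ∷ Γ)
  H₂ = there ∘ there ∘ H
  Δ₂ = x ⊑ ⌜ δ ⌝ ∙ bit b ∷ (x ⊑ bit a ∙ ⌜ δ ⌝ ∨' x ⊑ ⌜ δ ⌝ ∙ bit b) ∷ Γ
  x⊑⌜δb⌝ : Δ₂ ⊢ x ⊑ ⌜ δ ++ b ∷ [] ⌝
  x⊑⌜δb⌝ = subst (λ t → Δ₂ ⊢ x ⊑ t) (sym (⌜⌝-∷ʳ δ b)) (hyp (here refl))

module _ {m : ℕ} {Γ : List (Formula m)} where

  ⊑-complete : ∀ {n} → HasAx Γ → (s t : Term n) (α : Env n) → α ⊨ (s ⊑ t) →
               Γ ⊢ subF (numerals α) (s ⊑ t)
  ⊑-complete H s t α s≼t =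
    ⊑-respˡ-≐ (≐-sym (⌜⟦⟧⌝ H s α)) (⊑-respʳ-≐ (≐-sym (⌜⟦⟧⌝ H t α)) (⌜⌝-⊑ H (endsView (⟦ t ⟧ α)) s≼t))

  numerals-∃I : ∀ {n} (α : Env n) (x : BitString) (φ : Formula (suc n)) →
                Γ ⊢ subF (numerals (x ∷ᵉ α)) φ → Γ ⊢ subF (numerals α) (∃' φ)
  numerals-∃I α x φ = ∃I ⌜ x ⌝ ∘ subst (Γ ⊢_) (sym (extS-numerals-[⌜⌝] α x φ))

Σ-complete : ∀ {n m} {Γ : List (Formula m)} {φ : Formula n} → HasAx Γ → IsΣ φ →
             (α : Env n) → α ⊨ φ → Γ ⊢ subF (numerals α) φ
Σ-complete H (σ-⊑ s t) α s≼t = ⊑-complete H s t α s≼t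
Σ-complete {Γ = Γ} H (σ-¬⊑ s t) α s⋠t = ⇒I (⊑⌜⌝-cases H′ (endsView (⟦ t ⟧ α)) ⌜s⌝⊑⌜t⌝ refute)
  where
  Δ = subF (numerals α) (s ⊑ t) ∷ Γ
  H′ : HasAx Δ
  H′ = there ∘ H
  ⌜s⌝⊑⌜t⌝ : Δ ⊢ ⌜ ⟦ s ⟧ α ⌝ ⊑ ⌜ ⟦ t ⟧ α ⌝
  ⌜s⌝⊑⌜t⌝ = ⊑-respˡ-≐ (⌜⟦⟧⌝ H′ s α) (⊑-respʳ-≐ (⌜⟦⟧⌝ H′ t α) (hyp (here refl)))
  refute : ∀ {Δ′ δ} → Δ ⊆ Δ′ → δ ≼ ⟦ t ⟧ α → Δ′ ⊢ ⌜ ⟦ s ⟧ α ⌝ ≐ ⌜ δ ⌝ → Δ′ ⊢ ⊥'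
  refute ⊆Δ′ δ≼t = ⇒E (⌜⌝-≉ (⊆Δ′ ∘ H′) λ s≡δ → s⋠t (subst (_≼ ⟦ t ⟧ α) (sym s≡δ) δ≼t))
Σ-complete {Γ = Γ} H (σ-≐ s t) α s≡t =
  ≐-trans (⌜⟦⟧⌝ H s α) (subst (λ β → Γ ⊢ ⌜ β ⌝ ≐ subT (numerals α) t) (sym s≡t) (≐-sym (⌜⟦⟧⌝ H t α)))
Σ-complete {Γ = Γ} H (σ-¬≐ s t) α s≢t =
  ⇒I (⇒E (⌜⌝-≉ H′ s≢t) (≐-trans (≐-sym (⌜⟦⟧⌝ H′ s α)) (≐-trans (hyp (here refl)) (⌜⟦⟧⌝ H′ t α))))
  where
  H′ : HasAx (subF (numerals α) (s ≐ t) ∷ Γ)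
  H′ = there ∘ H
Σ-complete H (σ-∧ p q) α (sat₁ , sat₂) = ∧I (Σ-complete H p α sat₁) (Σ-complete H q α sat₂)
Σ-complete H (σ-∨ p q) α (inj₁ sat) = ∨I₁ (Σ-complete H p α sat)
Σ-complete H (σ-∨ p q) α (inj₂ sat) = ∨I₂ (Σ-complete H q α sat)
Σ-complete H (σ-∃ {φ} p) α (x , sat) = numerals-∃I α x φ (Σ-complete H p (x ∷ᵉ α) sat)
Σ-complete H (σ-∃⊑ t {φ} p) α (x , x≼t , sat) =
  numerals-∃I α x (var zero ⊑ wkT t ∧' φ)
    (∧I (⊑-complete H (var zero) (wkT t) (x ∷ᵉ α) x≼t) (Σ-complete H p (x ∷ᵉ α) sat))
Σ-complete {Γ = Γ} H (σ-∀⊑ t {φ} p) α sat = ∀I (⇒I (⊑⌜⌝-cases H′ (endsView (⟦ t ⟧ α)) x⊑⌜t⌝ instance-at))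
  where
  Δ = var zero ⊑ subT (extS (numerals α)) (wkT t) ∷ map wkF Γ
  H′ : HasAx Δ
  H′ = there ∘ map⁺ wkF H
  x⊑⌜t⌝ : Δ ⊢ var zero ⊑ ⌜ ⟦ t ⟧ α ⌝
  x⊑⌜t⌝ = ⊑-respʳ-≐ (⌜⟦⟧⌝ H′ t α)
    (subst (λ u → Δ ⊢ var zero ⊑ u) (trans (subT-extS-wkT (numerals α) t) (renT-subT-numerals suc α t))
           (hyp (here refl)))
  instance-at : ∀ {Δ′ δ} → Δ ⊆ Δ′ → δ ≼ ⟦ t ⟧ α → Δ′ ⊢ var zero ≐ ⌜ δ ⌝ → Δ′ ⊢ subF (extS (numerals α)) φ
  instance-at {δ = δ} ⊆Δ′ δ≼t x≐⌜δ⌝ =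
    leibniz (subF (extS (numerals α)) φ) (extS-numerals-[⌜⌝] α δ φ) (extS-numerals-[var0] α φ) (≐-sym x≐⌜δ⌝)
      (Σ-complete (⊆Δ′ ∘ H′) p (δ ∷ᵉ α) (sat δ (subst (δ ≼_) (sym (⟦⟧-wkT t δ α)) δ≼t)))

theorem4 : (φ : Sentence) → IsΣ φ → 𝔅⊨ φ → B⊢ φ
theorem4 φ σφ 𝔅⊨φ = subst (BAxioms ⊢_) (subF-id (λ ()) φ) (Σ-complete ⊆-refl σφ (λ ()) 𝔅⊨φ)
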